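{- Let $P$ be a process such that $\emptyset \vdash P$. Then for every process $Q$ with $P \rightarrow^{\star} Q$, the process $Q$ is not an error.
   Context: Names $a,b,c,\dots,x,y,z$ range over a countable set $\mathcal{N}$. Processes: $P,Q ::= 0 \mid P \mid Q \mid (\nu a)P \mid (a)P \mid \alpha.P$, with prefixes $\alpha ::= \overline{a}\langle b\rangle$ (output of $b$ on $a$) $\mid a(x)$ (input on $a$, binding $x$) $\mid \overline{a}\{b\}$ (send authorization for $b$ on $a$) $\mid a\{b\}$ (receive authorization for $b$ on $a$). Here $(a)P$ is the authorization scope (process $P$ is authorized to act on $a$); it does not bind $a$, and in $a\{b\}.P$ the name $b$ is not bound. Only $(\nu a)$ and input bind names. Free names: $\mathrm{fn}((a)P)=\{a\}\cup\mathrm{fn}(P)$, $\mathrm{fn}(\overline{a}\{b\}.P)=\mathrm{fn}(a\{b\}.P)=\{a,b\}\cup\mathrm{fn}(P)$, and as usual for the $\pi$-calculus otherwise. We write $\alpha_a$ for any prefix whose subject is $a$, i.e. $\overline{a}\langle b\rangle$, $a(x)$, $\overline{a}\{b\}$ or $a\{b\}$; $(\vec a)P$ abbreviates $(a_1)\cdots(a_k)P$. Structural congruence $\equiv$ is the least congruence satisfying: $P\mid 0\equiv P$; $P\mid Q\equiv Q\mid P$; $(P\mid Q)\mid R\equiv P\mid(Q\mid R)$; $(\nu a)0\equiv 0$; $(\nu a)(\nu b)P\equiv(\nu b)(\nu a)P$; $P\mid(\nu a)Q\equiv(\nu a)(P\mid Q)$ if $a\notin\mathrm{fn}(P)$; $\alpha$-equivalent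 processes are congruent; $(a)(b)P\equiv(b)(a)P$; $(a)0\equiv 0$; $(a)(P\mid Q)\equiv(a)P\mid(a)Q$; $(a)(\nu b)P\equiv(\nu b)(a)P$ if $a\neq b$. Reduction $\rightarrow$ is the least relation closed under: if $P\equiv P'\rightarrow Q'\equiv Q$ then $P\rightarrow Q$; if $P\rightarrow Q$ then $P\mid R\rightarrow Q\mid R$, $(\nu a)P\rightarrow(\nu a)Q$ and $(a)P\rightarrow(a)Q$; (comm) $(\vec a_1)(b)\overline{b}\langle c\rangle.P \mid (\vec a_2)(b)b(x).Q \rightarrow (\vec a_1)(b)P \mid (\vec a_2)(b)Q\{c/x\}$; (auth) $(\vec a_1)(b)(c)\overline{b}\{c\}.P \mid (\vec a_2)(b)b\{c\}.Q \rightarrow (\vec a_1)(b)P \mid (\vec a_2)(b)(c)Q$. $\rightarrow^{\star}$ is the reflexive-transitive closure. Active contexts: $C[\cdot] ::= \cdot \mid P\mid C[\cdot] \mid (\nu a)C[\cdot] \mid (a)C[\cdot]$. The predicate $\mathrm{auth}(C[\cdot],a)$ is: false if $C=\cdot$; true if $C=(a)C'$; $\mathrm{auth}(C',a)$ if $C=(b)C'$ with $b\neq a$, or $C=P\mid C'$, or $C=(\nu b)C'$. A process $P$ is an error if $P\equiv C[\alpha_a.Q]$ for some active context $C$, prefix $\alpha_a$ and $Q$ such that either $\mathrm{auth}(C[\cdot],a)$ is false, or $\alpha_a=\overline{a}\{b\}$ and $\mathrm{auth}(C[\cdot],b)$ is false. Typing: $\rho$ is a set of names; $\rho\vdash P$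 is the least relation closed under: $\emptyset\vdash 0$; from $\rho_1\vdash P$, $\rho_2\vdash Q$ infer $\rho_1\cup\rho_2\vdash P\mid Q$; from $\rho\vdash P$, $a\notin\rho$ infer $\rho\vdash(\nu a)P$; from $\rho\vdash P$ infer $\rho\setminus\{a\}\vdash(a)P$; from $\rho\vdash P$ infer $\rho\cup\{a\}\vdash\overline{a}\langle b\rangle.P$; from $\rho\vdash P$, $x\notin\rho$ infer $\rho\cup\{a\}\vdash a(x).P$; from $\rho\vdash P$, $b\notin\rho$ infer $\rho\cup\{a,b\}\vdash\overline{a}\{b\}.P$; from $\rho\vdash P$ infer $(\rho\setminus\{b\})\cup\{a\}\vdash a\{b\}.P$. -}

module Defs where

open import Data.Nat using (ℕ; _≡ᵇ_)
open import Data.Bool using (if_then_else_)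
open import Data.Empty using (⊥)
open import Data.Sum using (_⊎_)
open import Data.Product using (Σ; ∃; _×_)
open import Data.List using (List; []; _∷_)
open import Level using (0ℓ)
open import Relation.Nullary using (¬_)
open import Relation.Binary.PropositionalEquality using (_≡_)
open import Relation.Binary.Construct.Closure.ReflexiveTransitive using (Star)
open import Relation.Unary using (Pred; ∅; ｛_｝; _∪_; _∖_; _≐_; _∉_)

Name : Set
Name = ℕ

data Prefix : Set where
  out  : Name → Name → Prefix   -- ā⟨b⟩   output of b on a
  inp  : Name → Name → Prefix   -- a(x)   input on a, binding x
  aout : Name → Name → Prefix   -- ā{b}   send authorization for b on a
  ainp : Name → Name → Prefix   -- a{b}   receive authorization for b on a (b not bound)

subj : Prefix → Name
subj (out a _)  = a
subj (inp a _)  = a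
subj (aout a _) = a
subj (ainp a _) = a

infixr 6 _∥_
infixr 7 _·_

data Proc : Set where
  𝟘    : Proc
  _∥_  : Proc → Proc → Proc
  ν    : Name → Proc → Proc
  ⟨_⟩_ : Name → Proc → Proc        -- (a) P  authorization scope (not a binder)
  _·_  : Prefix → Proc → Proc

auths : List Name → Proc → Proc
auths []       P = P
auths (a ∷ as) P = ⟨ a ⟩ auths as P

data _∈fn_ (n : Name) : Proc → Set where
  parˡ  : ∀ {P Q} → n ∈fn P → n ∈fn (P ∥ Q)
  parʳ  : ∀ {P Q} → n ∈fn Q → n ∈fn (P ∥ Q)
  res   : ∀ {a P} → ¬ (n ≡ a) → n ∈fn P → n ∈fn ν a P
  authₕ : ∀ {P} → n ∈fn (⟨ n ⟩ P)
  auth  : ∀ {a P} → n ∈fn P → n ∈fn (⟨ a ⟩ P)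
  out₁  : ∀ {b P} → n ∈fn (out n b · P)
  out₂  : ∀ {a P} → n ∈fn (out a n · P)
  outₚ  : ∀ {a b P} → n ∈fn P → n ∈fn (out a b · P)
  inp₁  : ∀ {x P} → n ∈fn (inp n x · P)
  inpₚ  : ∀ {a x P} → ¬ (n ≡ x) → n ∈fn P → n ∈fn (inp a x · P)
  aout₁ : ∀ {b P} → n ∈fn (aout n b · P)
  aout₂ : ∀ {a P} → n ∈fn (aout a n · P)
  aoutₚ : ∀ {a b P} → n ∈fn P → n ∈fn (aout a b · P)
  ainp₁ : ∀ {b P} → n ∈fn (ainp n b · P)
  ainp₂ : ∀ {a P} → n ∈fn (ainp a n · P)
  ainpₚ : ∀ {a b P} → n ∈fn P → n ∈fn (ainp a b · P)

_∉fn_ : Name → Proc → Set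
n ∉fn P = ¬ (n ∈fn P)

data _∈bn_ (n : Name) : Proc → Set where
  parˡ  : ∀ {P Q} → n ∈bn P → n ∈bn (P ∥ Q)
  parʳ  : ∀ {P Q} → n ∈bn Q → n ∈bn (P ∥ Q)
  resₕ  : ∀ {P} → n ∈bn ν n P
  res   : ∀ {a P} → n ∈bn P → n ∈bn ν a P
  auth  : ∀ {a P} → n ∈bn P → n ∈bn (⟨ a ⟩ P)
  inpₕ  : ∀ {a P} → n ∈bn (inp a n · P)
  pre   : ∀ {π P} → n ∈bn P → n ∈bn (π · P)

swapN : Name → Name → Name → Name
swapN a b n = if n ≡ᵇ a then b else (if n ≡ᵇ b then a else n)

swapPre : Name → Name → Prefix → Prefix
swapPre a b (out c d)  = out (swapN a b c) (swapN a b d)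
swapPre a b (inp c d)  = inp (swapN a b c) (swapN a b d)
swapPre a b (aout c d) = aout (swapN a b c) (swapN a b d)
swapPre a b (ainp c d) = ainp (swapN a b c) (swapN a b d)

swap : Name → Name → Proc → Proc
swap a b 𝟘         = 𝟘
swap a b (P ∥ Q)   = swap a b P ∥ swap a b Q
swap a b (ν c P)   = ν (swapN a b c) (swap a b P)
swap a b (⟨ c ⟩ P) = ⟨ swapN a b c ⟩ swap a b P
swap a b (π · P)   = swapPre a b π · swap a b P

rn : Name → Name → Name → Name
rn c x n = if n ≡ᵇ x then c else n

-- It does not rename binders; it is only used (in the comm rule) under the
-- side condition that c is not a binder of P, in which case it coincides with
-- capture-avoiding substitution.  (Reduction is closed under ≡, which
-- contains α-conversion, so bound names can always be renamed first.)
_[_/_] : Proc → Name → Name → Proc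
𝟘 [ c / x ]                = 𝟘
(P ∥ Q) [ c / x ]          = P [ c / x ] ∥ Q [ c / x ]
ν y P [ c / x ]            = if y ≡ᵇ x then ν y P else ν y (P [ c / x ])
(⟨ a ⟩ P) [ c / x ]        = ⟨ rn c x a ⟩ (P [ c / x ])
(out a b · P) [ c / x ]    = out (rn c x a) (rn c x b) · P [ c / x ]
(inp a y · P) [ c / x ]    = inp (rn c x a) y · (if y ≡ᵇ x then P else P [ c / x ])
(aout a b · P) [ c / x ]   = aout (rn c x a) (rn c x b) · P [ c / x ]
(ainp a b · P) [ c / x ]   = ainp (rn c x a) (rn c x b) · P [ c / x ]

infix 4 _≡ₛ_
data _≡ₛ_ : Proc → Proc → Set where
  refl  : ∀ {P} → P ≡ₛ P
  sym   : ∀ {P Q} → P ≡ₛ Q → Q ≡ₛ P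
  trans : ∀ {P Q R} → P ≡ₛ Q → Q ≡ₛ R → P ≡ₛ R
  c-par  : ∀ {P P′ Q Q′} → P ≡ₛ P′ → Q ≡ₛ Q′ → (P ∥ Q) ≡ₛ (P′ ∥ Q′)
  c-res  : ∀ {a P Q} → P ≡ₛ Q → ν a P ≡ₛ ν a Q
  c-auth : ∀ {a P Q} → P ≡ₛ Q → (⟨ a ⟩ P) ≡ₛ (⟨ a ⟩ Q)
  c-pre  : ∀ {π P Q} → P ≡ₛ Q → (π · P) ≡ₛ (π · Q)
  par-unit  : ∀ {P} → (P ∥ 𝟘) ≡ₛ P
  par-comm  : ∀ {P Q} → (P ∥ Q) ≡ₛ (Q ∥ P)
  par-assoc : ∀ {P Q R} → ((P ∥ Q) ∥ R) ≡ₛ (P ∥ (Q ∥ R))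
  res-zero  : ∀ {a} → ν a 𝟘 ≡ₛ 𝟘
  res-swap  : ∀ {a b P} → ν a (ν b P) ≡ₛ ν b (ν a P)
  scope-ext : ∀ {a P Q} → a ∉fn P → (P ∥ ν a Q) ≡ₛ ν a (P ∥ Q)
  α-res     : ∀ {a b P} → b ∉fn P → ν a P ≡ₛ ν b (swap a b P)
  α-inp     : ∀ {a x y P} → y ∉fn P → (inp a x · P) ≡ₛ (inp a y · swap x y P)
  auth-swap : ∀ {a b P} → (⟨ a ⟩ ⟨ b ⟩ P) ≡ₛ (⟨ b ⟩ ⟨ a ⟩ P)
  auth-zero : ∀ {a} → (⟨ a ⟩ 𝟘) ≡ₛ 𝟘
  auth-par  : ∀ {a P Q} → (⟨ a ⟩ (P ∥ Q)) ≡ₛ ((⟨ a ⟩ P) ∥ (⟨ a ⟩ Q))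
  auth-res  : ∀ {a b P} → ¬ (a ≡ b) → (⟨ a ⟩ ν b P) ≡ₛ ν b (⟨ a ⟩ P)

infix 4 _⟶_
data _⟶_ : Proc → Proc → Set where
  struct : ∀ {P P′ Q′ Q} → P ≡ₛ P′ → P′ ⟶ Q′ → Q′ ≡ₛ Q → P ⟶ Q
  r-par  : ∀ {P Q R} → P ⟶ Q → (P ∥ R) ⟶ (Q ∥ R)
  r-res  : ∀ {a P Q} → P ⟶ Q → ν a P ⟶ ν a Q
  r-auth : ∀ {a P Q} → P ⟶ Q → (⟨ a ⟩ P) ⟶ (⟨ a ⟩ Q)
  comm   : ∀ (as₁ as₂ : List Name) (b c x : Name) (P Q : Proc) →
           ¬ (c ∈bn Q) →
           (auths as₁ (⟨ b ⟩ (out b c · P)) ∥ auths as₂ (⟨ b ⟩ (inp b x · Q)))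
             ⟶ (auths as₁ (⟨ b ⟩ P) ∥ auths as₂ (⟨ b ⟩ (Q [ c / x ])))
  authr  : ∀ (as₁ as₂ : List Name) (b c : Name) (P Q : Proc) →
           (auths as₁ (⟨ b ⟩ ⟨ c ⟩ (aout b c · P)) ∥ auths as₂ (⟨ b ⟩ (ainp b c · Q)))
             ⟶ (auths as₁ (⟨ b ⟩ P) ∥ auths as₂ (⟨ b ⟩ ⟨ c ⟩ Q))

_⟶⋆_ : Proc → Proc → Set
_⟶⋆_ = Star _⟶_

data Ctx : Set where
  hole : Ctx
  par  : Proc → Ctx → Ctx
  res  : Name → Ctx → Ctx
  auth : Name → Ctx → Ctx

plug : Ctx → Proc → Proc
plug hole       R = R
plug (par P C)  R = P ∥ plug C R
plug (res a C)  R = ν a (plug C R)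
plug (auth a C) R = ⟨ a ⟩ plug C R

Auth : Ctx → Name → Set
Auth hole       a = ⊥
Auth (par _ C)  a = Auth C a
Auth (res _ C)  a = Auth C a
Auth (auth b C) a = (b ≡ a) ⊎ Auth C a

BadPrefix : Ctx → Prefix → Set
BadPrefix C π = (¬ Auth C (subj π)) ⊎ (Σ Name λ a → Σ Name λ b → (π ≡ aout a b) × ¬ Auth C b)

Error : Proc → Set
Error P = Σ Ctx λ C → Σ Prefix λ π → Σ Proc λ Q → (P ≡ₛ plug C (π · Q)) × BadPrefix C π

-- Typing  ρ ⊢ P,  with ρ a set of names (a predicate on names).
-- Sets are extensional, so the judgement is closed under extensional
-- equality ≐ of name sets (rule t-ext).

NameSet : Set₁
NameSet = Pred Name 0ℓ

infix 3 _⊢ₜ_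
data _⊢ₜ_ : NameSet → Proc → Set₁ where
  t-zero : ∅ ⊢ₜ 𝟘
  t-par  : ∀ {ρ₁ ρ₂ P Q} → ρ₁ ⊢ₜ P → ρ₂ ⊢ₜ Q → (ρ₁ ∪ ρ₂) ⊢ₜ (P ∥ Q)
  t-res  : ∀ {ρ a P} → ρ ⊢ₜ P → a ∉ ρ → ρ ⊢ₜ ν a P
  t-auth : ∀ {ρ a P} → ρ ⊢ₜ P → (ρ ∖ ｛ a ｝) ⊢ₜ (⟨ a ⟩ P)
  t-out  : ∀ {ρ a b P} → ρ ⊢ₜ P → (ρ ∪ ｛ a ｝) ⊢ₜ (out a b · P)
  t-inp  : ∀ {ρ a x P} → ρ ⊢ₜ P → x ∉ ρ → (ρ ∪ ｛ a ｝) ⊢ₜ (inp a x · P)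
  t-aout : ∀ {ρ a b P} → ρ ⊢ₜ P → b ∉ ρ → (ρ ∪ (｛ a ｝ ∪ ｛ b ｝)) ⊢ₜ (aout a b · P)
  t-ainp : ∀ {ρ a b P} → ρ ⊢ₜ P → ((ρ ∖ ｛ b ｝) ∪ ｛ a ｝) ⊢ₜ (ainp a b · P)
  t-ext  : ∀ {ρ ρ′ P} → ρ ⊢ₜ P → ρ ≐ ρ′ → ρ′ ⊢ₜ P

-- Rather than proving subject reduction for ⊢ₜ, we use a semantic invariant.
-- An environment M counts the authorizations held for each name, and
-- Safe M P states that every prefix of P is authorized when P runs under M:
-- scopes (a) and receptions a{b} grant authorizations, ā{b} spends one, and
-- restricted or input-bound names start with none.
module Submission where

open import Defs
open import Relation.Nullary using (¬_; yes; no)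
open import Relation.Unary using (∅; _∈_; _∉_)

open import Data.Nat using (ℕ; suc; pred; _+_; _≤_; _<_; z≤n; s≤s; _≡ᵇ_)
open import Data.Nat.Properties
  using (_≟_; +-suc; +-identityʳ; m≤m+n; m≤n+m; pred-mono-≤; n≮0; <-≤-trans; ≤-reflexive; ≤-refl; ≤-trans)
open import Data.Bool using (true; false; if_then_else_)
open import Data.Unit using (⊤; tt)
open import Data.Empty using (⊥-elim)
open import Data.Sum using (inj₁; inj₂)
open import Data.Product using (Σ; _×_; _,_; proj₁; proj₂)
open import Data.List using ([]; _∷_)
open import Function using (_∘_)
open import Relation.Nullary.Decidable using (proof)
open import Relation.Nullary.Reflects using (Reflects; ofʸ; ofⁿ)
open import Relation.Binary.PropositionalEquality
  using (_≡_; _≢_; _≗_; refl; cong; cong₂; subst; module ≡-Reasoning)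
  renaming (sym to ≡-sym; trans to ≡-trans)
open import Relation.Binary.Construct.Closure.ReflexiveTransitive using (ε; _◅_)

-- Boolean equality of names reflects propositional equality; matching on
-- `m ≡ᵇ n | ≡ᵇ-reflects m n` evaluates the tests `if m ≡ᵇ n …` of Defs.
≡ᵇ-reflects : ∀ m n → Reflects (m ≡ n) (m ≡ᵇ n)
≡ᵇ-reflects m n = proof (m ≟ n)

Env : Set
Env = Name → ℕ

upd : (ℕ → ℕ) → Name → Env → Env
upd g a M n = if n ≡ᵇ a then g (M n) else M n

reset inc dec : Name → Env → Env
reset = upd (λ _ → 0)
inc   = upd suc
dec   = upd pred

upd-≡ : ∀ g a M {n} → n ≡ a → upd g a M n ≡ g (M n)
upd-≡ g a M {n} n≡a with n ≡ᵇ a | ≡ᵇ-reflects n a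
... | true  | _        = refl
... | false | ofⁿ n≢a = ⊥-elim (n≢a n≡a)

upd-≢ : ∀ g a M {n} → n ≢ a → upd g a M n ≡ M n
upd-≢ g a M {n} n≢a with n ≡ᵇ a | ≡ᵇ-reflects n a
... | true  | ofʸ n≡a = ⊥-elim (n≢a n≡a)
... | false | _        = refl

upd-cong : ∀ g a {M M′} → M ≗ M′ → upd g a M ≗ upd g a M′
upd-cong g a {M} {M′} M≗M′ n = cong (λ v → if n ≡ᵇ a then g v else v) (M≗M′ n)

upd-cong-fun : ∀ {g g′} a M → (∀ m → g m ≡ g′ m) → upd g a M ≗ upd g′ a M
upd-cong-fun a M g≗g′ n = cong (λ v → if n ≡ᵇ a then v else M n) (g≗g′ (M n))

upd-id : ∀ g a M → (∀ m → g m ≡ m) → upd g a M ≗ M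
upd-id g a M g≗id n with n ≡ᵇ a
... | true  = g≗id (M n)
... | false = refl

upd-∘ : ∀ g h a M → upd g a (upd h a M) ≗ upd (g ∘ h) a M
upd-∘ g h a M n with n ≡ᵇ a
... | true  = refl
... | false = refl

upd-comm : ∀ g h a b M → (∀ n → n ≡ a → n ≡ b → g (h (M n)) ≡ h (g (M n))) →
           upd g a (upd h b M) ≗ upd h b (upd g a M)
upd-comm g h a b M gh≡hg n with n ≡ᵇ a | ≡ᵇ-reflects n a | n ≡ᵇ b | ≡ᵇ-reflects n b
... | true  | ofʸ n≡a | true  | ofʸ n≡b = gh≡hg n n≡a n≡b
... | true  | _        | false | _        = refl
... | false | _        | true  | _        = refl
... | false | _        | false | _        = refl

upd-mono : ∀ g a M M′ n → (n ≡ a → g (M n) ≤ g (M′ n)) → (n ≢ a → M n ≤ M′ n) →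
           upd g a M n ≤ upd g a M′ n
upd-mono g a M M′ n at-a elsewhere with n ≡ᵇ a | ≡ᵇ-reflects n a
... | true  | ofʸ n≡a = at-a n≡a
... | false | ofⁿ n≢a = elsewhere n≢a

upd-increasing : ∀ g a M n → (∀ m → m ≤ g m) → M n ≤ upd g a M n
upd-increasing g a M n g≥id with n ≡ᵇ a
... | true  = g≥id (M n)
... | false = ≤-refl

reset-≤ : ∀ a M n → reset a M n ≤ M n
reset-≤ a M n with n ≡ᵇ a
... | true  = z≤n
... | false = ≤-refl

inc-pos : ∀ a M n → (n ≢ a → 0 < M n) → 0 < inc a M n
inc-pos a M n pos with n ≡ᵇ a | ≡ᵇ-reflects n a
... | true  | _        = s≤s z≤n
... | false | ofⁿ n≢a = pos n≢a

-- Counts (not sets) are needed because a process may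
-- hold several authorizations for the same name and give them away one by one.
Safe : Env → Proc → Set
Safe M 𝟘              = ⊤
Safe M (P ∥ Q)        = Safe M P × Safe M Q
Safe M (ν a P)        = Safe (reset a M) P
Safe M (⟨ a ⟩ P)      = Safe (inc a M) P
Safe M (out a b · P)  = 0 < M a × Safe M P
Safe M (inp a x · P)  = 0 < M a × Safe (reset x M) P
Safe M (aout a b · P) = 0 < M a × 0 < M b × Safe (dec b M) P
Safe M (ainp a b · P) = 0 < M a × Safe (inc b M) P

Safe-mono : ∀ P {M M′} → (∀ n → n ∈fn P → M n ≤ M′ n) → Safe M P → Safe M′ P
Safe-mono 𝟘 M≤M′ _ = tt
Safe-mono (P ∥ Q) M≤M′ (safeP , safeQ) =
  Safe-mono P (λ n → M≤M′ n ∘ parˡ) safeP , Safe-mono Q (λ n → M≤M′ n ∘ parʳ) safeQ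
Safe-mono (ν a P) {M} {M′} M≤M′ safe =
  Safe-mono P (λ n n∈P → upd-mono _ a M M′ n (λ _ → z≤n) (λ n≢a → M≤M′ n (res n≢a n∈P))) safe
Safe-mono (⟨ a ⟩ P) {M} {M′} M≤M′ safe =
  Safe-mono P (λ n n∈P → upd-mono suc a M M′ n (λ _ → s≤s (M≤M′ n (auth n∈P)))
                                                (λ _ → M≤M′ n (auth n∈P))) safe
Safe-mono (out a b · P) M≤M′ (pos , safe) =
  <-≤-trans pos (M≤M′ a out₁) , Safe-mono P (λ n → M≤M′ n ∘ outₚ) safe
Safe-mono (inp a x · P) {M} {M′} M≤M′ (pos , safe) =
  <-≤-trans pos (M≤M′ a inp₁) ,
  Safe-mono P (λ n n∈P → upd-mono _ x M M′ n (λ _ → z≤n) (λ n≢x → M≤M′ n (inpₚ n≢x n∈P))) safe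
Safe-mono (aout a b · P) {M} {M′} M≤M′ (posa , posb , safe) =
  <-≤-trans posa (M≤M′ a aout₁) , <-≤-trans posb (M≤M′ b aout₂) ,
  Safe-mono P (λ n n∈P → upd-mono pred b M M′ n (λ { refl → pred-mono-≤ (M≤M′ b aout₂) })
                                                 (λ _ → M≤M′ n (aoutₚ n∈P))) safe
Safe-mono (ainp a b · P) {M} {M′} M≤M′ (pos , safe) =
  <-≤-trans pos (M≤M′ a ainp₁) ,
  Safe-mono P (λ n n∈P → upd-mono suc b M M′ n (λ { refl → s≤s (M≤M′ b ainp₂) })
                                                (λ _ → M≤M′ n (ainpₚ n∈P))) safe

Safe-≗ : ∀ P {M M′} → M ≗ M′ → Safe M P → Safe M′ P
Safe-≗ P M≗M′ = Safe-mono P (λ n _ → ≤-reflexive (M≗M′ n))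

reset-fresh : ∀ {P} a M → a ∉fn P → ∀ n → n ∈fn P → reset a M n ≡ M n
reset-fresh {P} a M a∉P n n∈P = upd-≢ _ a M (λ n≡a → a∉P (subst (_∈fn P) n≡a n∈P))

module Swapping (a b : Name) where

  swapN-left : swapN a b a ≡ b
  swapN-left with a ≡ᵇ a | ≡ᵇ-reflects a a
  ... | true  | _        = refl
  ... | false | ofⁿ a≢a = ⊥-elim (a≢a refl)

  swapN-right : swapN a b b ≡ a
  swapN-right with b ≡ᵇ a | ≡ᵇ-reflects b a
  ... | true  | ofʸ b≡a = b≡a
  ... | false | _ with b ≡ᵇ b | ≡ᵇ-reflects b b
  ...   | true  | _        = refl
  ...   | false | ofⁿ b≢b = ⊥-elim (b≢b refl)

  swapN-other : ∀ {n} → n ≢ a → n ≢ b → swapN a b n ≡ n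
  swapN-other {n} n≢a n≢b with n ≡ᵇ a | ≡ᵇ-reflects n a
  ... | true  | ofʸ n≡a = ⊥-elim (n≢a n≡a)
  ... | false | _ with n ≡ᵇ b | ≡ᵇ-reflects n b
  ...   | true  | ofʸ n≡b = ⊥-elim (n≢b n≡b)
  ...   | false | _        = refl

  swapN-involutive : ∀ n → swapN a b (swapN a b n) ≡ n
  swapN-involutive n with n ≟ a
  ... | yes refl = ≡-trans (cong (swapN a b) swapN-left) swapN-right
  ... | no n≢a with n ≟ b
  ...   | yes refl = ≡-trans (cong (swapN a b) swapN-right) swapN-left
  ...   | no n≢b = ≡-trans (cong (swapN a b) (swapN-other n≢a n≢b)) (swapN-other n≢a n≢b)

  swapN-transpose : ∀ {n m} → swapN a b n ≡ m → n ≡ swapN a b m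
  swapN-transpose {n} σn≡m = ≡-trans (≡-sym (swapN-involutive n)) (cong (swapN a b) σn≡m)

  upd-swap : ∀ g c M n → upd g c M (swapN a b n) ≡ upd g (swapN a b c) (M ∘ swapN a b) n
  upd-swap g c M n with swapN a b n ≟ c
  ... | yes σn≡c = ≡-trans (upd-≡ g c M σn≡c)
                           (≡-sym (upd-≡ g (swapN a b c) (M ∘ swapN a b) (swapN-transpose {n} σn≡c)))
  ... | no σn≢c = ≡-trans (upd-≢ g c M σn≢c)
                          (≡-sym (upd-≢ g (swapN a b c) (M ∘ swapN a b) {n}
                                        (λ n≡σc → σn≢c (≡-sym (swapN-transpose {c} (≡-sym n≡σc))))))

  pos-swap : ∀ (M : Env) c → 0 < M c → 0 < M (swapN a b (swapN a b c))
  pos-swap M c = subst (λ m → 0 < M m) (≡-sym (swapN-involutive c))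

  Safe-swap : ∀ P {M} → Safe M P → Safe (M ∘ swapN a b) (swap a b P)
  Safe-swap 𝟘 _ = tt
  Safe-swap (P ∥ Q) (safeP , safeQ) = Safe-swap P safeP , Safe-swap Q safeQ
  Safe-swap (ν c P) {M} safe = Safe-≗ (swap a b P) (upd-swap _ c M) (Safe-swap P safe)
  Safe-swap (⟨ c ⟩ P) {M} safe = Safe-≗ (swap a b P) (upd-swap suc c M) (Safe-swap P safe)
  Safe-swap (out c d · P) {M} (pos , safe) = pos-swap M c pos , Safe-swap P safe
  Safe-swap (inp c x · P) {M} (pos , safe) =
    pos-swap M c pos , Safe-≗ (swap a b P) (upd-swap _ x M) (Safe-swap P safe)
  Safe-swap (aout c d · P) {M} (posc , posd , safe) =
    pos-swap M c posc , pos-swap M d posd , Safe-≗ (swap a b P) (upd-swap pred d M) (Safe-swap P safe)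
  Safe-swap (ainp c d · P) {M} (pos , safe) =
    pos-swap M c pos , Safe-≗ (swap a b P) (upd-swap suc d M) (Safe-swap P safe)

  swapPre-involutive : ∀ π → swapPre a b (swapPre a b π) ≡ π
  swapPre-involutive (out c d)  = cong₂ out (swapN-involutive c) (swapN-involutive d)
  swapPre-involutive (inp c d)  = cong₂ inp (swapN-involutive c) (swapN-involutive d)
  swapPre-involutive (aout c d) = cong₂ aout (swapN-involutive c) (swapN-involutive d)
  swapPre-involutive (ainp c d) = cong₂ ainp (swapN-involutive c) (swapN-involutive d)

  swap-involutive : ∀ P → swap a b (swap a b P) ≡ P
  swap-involutive 𝟘         = refl
  swap-involutive (P ∥ Q)   = cong₂ _∥_ (swap-involutive P) (swap-involutive Q)
  swap-involutive (ν c P)   = cong₂ ν (swapN-involutive c) (swap-involutive P)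
  swap-involutive (⟨ c ⟩ P) = cong₂ ⟨_⟩_ (swapN-involutive c) (swap-involutive P)
  swap-involutive (π · P)   = cong₂ _·_ (swapPre-involutive π) (swap-involutive P)

  ∈fn-swap : ∀ P n → n ∈fn swap a b P → swapN a b n ∈fn P
  ∈fn-swap (P ∥ Q) n (parˡ n∈) = parˡ (∈fn-swap P n n∈)
  ∈fn-swap (P ∥ Q) n (parʳ n∈) = parʳ (∈fn-swap Q n n∈)
  ∈fn-swap (ν c P) n (res n≢σc n∈) =
    res (λ σn≡c → n≢σc (swapN-transpose {n} σn≡c)) (∈fn-swap P n n∈)
  ∈fn-swap (⟨ c ⟩ P) _ authₕ rewrite swapN-involutive c = authₕ
  ∈fn-swap (⟨ c ⟩ P) n (auth n∈) = auth (∈fn-swap P n n∈)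
  ∈fn-swap (out c d · P) _ out₁ rewrite swapN-involutive c = out₁
  ∈fn-swap (out c d · P) _ out₂ rewrite swapN-involutive d = out₂
  ∈fn-swap (out c d · P) n (outₚ n∈) = outₚ (∈fn-swap P n n∈)
  ∈fn-swap (inp c x · P) _ inp₁ rewrite swapN-involutive c = inp₁
  ∈fn-swap (inp c x · P) n (inpₚ n≢σx n∈) =
    inpₚ (λ σn≡x → n≢σx (swapN-transpose {n} σn≡x)) (∈fn-swap P n n∈)
  ∈fn-swap (aout c d · P) _ aout₁ rewrite swapN-involutive c = aout₁
  ∈fn-swap (aout c d · P) _ aout₂ rewrite swapN-involutive d = aout₂
  ∈fn-swap (aout c d · P) n (aoutₚ n∈) = aoutₚ (∈fn-swap P n n∈)
  ∈fn-swap (ainp c d · P) _ ainp₁ rewrite swapN-involutive c = ainp₁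
  ∈fn-swap (ainp c d · P) _ ainp₂ rewrite swapN-involutive d = ainp₂
  ∈fn-swap (ainp c d · P) n (ainpₚ n∈) = ainpₚ (∈fn-swap P n n∈)

  reset-swap : ∀ {P} M → b ∉fn P → ∀ n → n ∈fn P → reset b M (swapN a b n) ≡ reset a M n
  reset-swap M b∉P n n∈P with n ≟ a
  ... | yes refl = ≡-trans (upd-≡ _ b M swapN-left) (≡-sym (upd-≡ _ a M refl))
  ... | no n≢a with n ≟ b
  ...   | yes refl = ⊥-elim (b∉P n∈P)
  ...   | no n≢b = ≡-trans (cong (reset b M) (swapN-other n≢a n≢b))
                           (≡-trans (upd-≢ _ b M n≢b) (≡-sym (upd-≢ _ a M n≢a)))

  α-safe : ∀ P M → b ∉fn P → Safe (reset a M) P → Safe (reset b M) (swap a b P)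
  α-safe P M b∉P safe =
    Safe-mono (swap a b P) (λ n n∈ → ≤-reflexive (reset-swap-back n n∈)) (Safe-swap P safe)
    where
    reset-swap-back : ∀ n → n ∈fn swap a b P → reset a M (swapN a b n) ≡ reset b M n
    reset-swap-back n n∈ = ≡-sym (≡-trans (cong (reset b M) (≡-sym (swapN-involutive n)))
                                          (reset-swap M b∉P (swapN a b n) (∈fn-swap P n n∈)))

  α-safe⁻¹ : ∀ P M → b ∉fn P → Safe (reset b M) (swap a b P) → Safe (reset a M) P
  α-safe⁻¹ P M b∉P safe =
    Safe-mono P (λ n n∈ → ≤-reflexive (reset-swap M b∉P n n∈))
              (subst (Safe _) (swap-involutive P) (Safe-swap (swap a b P) safe))

rn-self : ∀ c a → rn c c a ≡ a
rn-self c a with a ≡ᵇ c | ≡ᵇ-reflects a c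
... | true  | ofʸ a≡c = ≡-sym a≡c
... | false | _        = refl

subst-self : ∀ P c → P [ c / c ] ≡ P
subst-self 𝟘 c = refl
subst-self (P ∥ Q) c = cong₂ _∥_ (subst-self P c) (subst-self Q c)
subst-self (ν y P) c with y ≡ᵇ c
... | true  = refl
... | false = cong (ν y) (subst-self P c)
subst-self (⟨ a ⟩ P) c = cong₂ ⟨_⟩_ (rn-self c a) (subst-self P c)
subst-self (out a b · P) c = cong₂ _·_ (cong₂ out (rn-self c a) (rn-self c b)) (subst-self P c)
subst-self (inp a y · P) c with y ≡ᵇ c
... | true  = cong (λ a′ → inp a′ y · P) (rn-self c a)
... | false = cong₂ (λ a′ P′ → inp a′ y · P′) (rn-self c a) (subst-self P c)
subst-self (aout a b · P) c = cong₂ _·_ (cong₂ aout (rn-self c a) (rn-self c b)) (subst-self P c)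
subst-self (ainp a b · P) c = cong₂ _·_ (cong₂ ainp (rn-self c a) (rn-self c b)) (subst-self P c)

-- g acts on the value v as a translation (suc always does, pred on positive v);
-- such updates commute with adding counts together.
Shifts : (ℕ → ℕ) → ℕ → Set
Shifts g v = (∀ k → g v + k ≡ g (v + k)) × (∀ m → m + g v ≡ g (m + v))

suc-shifts : ∀ v → Shifts suc v
suc-shifts v = (λ _ → refl) , (λ m → +-suc m v)

pred-shifts : ∀ v → 0 < v → Shifts pred v
pred-shifts (suc v) _ = (λ _ → refl) , (λ m → ≡-sym (cong pred (+-suc m v)))

-- Substitution of c for x transfers every authorization for x to c:
-- Safe N Q implies Safe (merge N) (Q [ c / x ]), as long as c is not bound in Q.
module Merge (x c : Name) (x≢c : x ≢ c) where
  open ≡-Reasoning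

  merge : Env → Env
  merge N = upd (_+ N x) c (reset x N)

  merge-≥ : ∀ N {n} → n ≢ x → N n ≤ merge N n
  merge-≥ N {n} n≢x = ≤-trans (≤-reflexive (≡-sym (upd-≢ _ x N n≢x)))
                              (upd-increasing (_+ N x) c (reset x N) n (λ m → m≤m+n m (N x)))

  merge-pos : ∀ a N → 0 < N a → 0 < merge N (rn c x a)
  merge-pos a N pos with a ≡ᵇ x | ≡ᵇ-reflects a x
  ... | true  | ofʸ refl = <-≤-trans pos (≤-trans (m≤n+m (N x) (reset x N c))
                                                   (≤-reflexive (≡-sym (upd-≡ (_+ N x) c (reset x N) refl))))
  ... | false | ofⁿ a≢x = <-≤-trans pos (merge-≥ N a≢x)

  -- Below a binder for x the substitution stops, and merging only adds counts.
  merge-bound : ∀ P N → Safe (reset x N) P → Safe (reset x (merge N)) P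
  merge-bound P N = Safe-mono P (λ n _ → upd-mono _ x N (merge N) n (λ _ → z≤n) (merge-≥ N))

  merge-reset : ∀ N y → y ≢ x → y ≢ c → merge (reset y N) ≗ reset y (merge N)
  merge-reset N y y≢x y≢c n = begin
      upd (_+ reset y N x) c (reset x (reset y N)) n
    ≡⟨ cong (λ k → upd (_+ k) c (reset x (reset y N)) n) (upd-≢ _ y N (y≢x ∘ ≡-sym)) ⟩
      upd (_+ N x) c (reset x (reset y N)) n
    ≡⟨ upd-cong (_+ N x) c (upd-comm _ _ x y N (λ _ _ _ → refl)) n ⟩
      upd (_+ N x) c (reset y (reset x N)) n
    ≡⟨ upd-comm (_+ N x) _ c y (reset x N) (λ _ m≡c m≡y → ⊥-elim (y≢c (≡-trans (≡-sym m≡y) m≡c))) n ⟩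
      reset y (merge N) n ∎

  merge-upd : ∀ g a N → Shifts g (N a) → merge (upd g a N) ≗ upd g (rn c x a) (merge N)
  merge-upd g a N (shiftˡ , shiftʳ) n with a ≡ᵇ x | ≡ᵇ-reflects a x
  ... | true  | ofʸ refl = begin
      upd (_+ upd g x N x) c (reset x (upd g x N)) n
    ≡⟨ cong (λ k → upd (_+ k) c (reset x (upd g x N)) n) (upd-≡ g x N refl) ⟩
      upd (_+ g (N x)) c (reset x (upd g x N)) n
    ≡⟨ upd-cong (_+ g (N x)) c (upd-∘ _ g x N) n ⟩
      upd (_+ g (N x)) c (reset x N) n
    ≡⟨ upd-cong-fun c (reset x N) shiftʳ n ⟩
      upd (g ∘ (_+ N x)) c (reset x N) n
    ≡⟨ ≡-sym (upd-∘ g (_+ N x) c (reset x N) n) ⟩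
      upd g c (merge N) n ∎
  ... | false | ofⁿ a≢x = begin
      upd (_+ upd g a N x) c (reset x (upd g a N)) n
    ≡⟨ cong (λ k → upd (_+ k) c (reset x (upd g a N)) n) (upd-≢ g a N (a≢x ∘ ≡-sym)) ⟩
      upd (_+ N x) c (reset x (upd g a N)) n
    ≡⟨ upd-cong (_+ N x) c (upd-comm _ g x a N (λ _ m≡x m≡a → ⊥-elim (a≢x (≡-trans (≡-sym m≡a) m≡x)))) n ⟩
      upd (_+ N x) c (upd g a (reset x N)) n
    ≡⟨ upd-comm (_+ N x) g c a (reset x N) shift-at-a n ⟩
      upd g a (merge N) n ∎
    where
    shift-at-a : ∀ m → m ≡ c → m ≡ a → g (reset x N m) + N x ≡ g (reset x N m + N x)
    shift-at-a _ _ refl rewrite upd-≢ (λ _ → 0) x N a≢x = shiftˡ (N x)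

  merge-inc : ∀ a N → merge (inc a N) ≗ inc (rn c x a) (merge N)
  merge-inc a N = merge-upd suc a N (suc-shifts (N a))

  merge-dec : ∀ a N → 0 < N a → merge (dec a N) ≗ dec (rn c x a) (merge N)
  merge-dec a N pos = merge-upd pred a N (pred-shifts (N a) pos)

  subst-safe : ∀ Q {N} → ¬ (c ∈bn Q) → Safe N Q → Safe (merge N) (Q [ c / x ])
  subst-safe 𝟘 _ _ = tt
  subst-safe (P ∥ Q) c∉ (safeP , safeQ) = subst-safe P (c∉ ∘ parˡ) safeP , subst-safe Q (c∉ ∘ parʳ) safeQ
  subst-safe (ν y P) {N} c∉ safe with y ≡ᵇ x | ≡ᵇ-reflects y x
  ... | true  | ofʸ refl = merge-bound P N safe
  ... | false | ofⁿ y≢x =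
    Safe-≗ (P [ c / x ]) (merge-reset N y y≢x y≢c) (subst-safe P (c∉ ∘ res) safe)
    where
    y≢c : y ≢ c
    y≢c refl = c∉ resₕ
  subst-safe (⟨ a ⟩ P) {N} c∉ safe =
    Safe-≗ (P [ c / x ]) (merge-inc a N) (subst-safe P (c∉ ∘ auth) safe)
  subst-safe (out a b · P) {N} c∉ (pos , safe) = merge-pos a N pos , subst-safe P (c∉ ∘ pre) safe
  subst-safe (inp a y · P) {N} c∉ (pos , safe) with y ≡ᵇ x | ≡ᵇ-reflects y x
  ... | true  | ofʸ refl = merge-pos a N pos , merge-bound P N safe
  ... | false | ofⁿ y≢x =
    merge-pos a N pos , Safe-≗ (P [ c / x ]) (merge-reset N y y≢x y≢c) (subst-safe P (c∉ ∘ pre) safe)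
    where
    y≢c : y ≢ c
    y≢c refl = c∉ inpₕ
  subst-safe (aout a b · P) {N} c∉ (posa , posb , safe) =
    merge-pos a N posa , merge-pos b N posb ,
    Safe-≗ (P [ c / x ]) (merge-dec b N posb) (subst-safe P (c∉ ∘ pre) safe)
  subst-safe (ainp a b · P) {N} c∉ (pos , safe) =
    merge-pos a N pos , Safe-≗ (P [ c / x ]) (merge-inc b N) (subst-safe P (c∉ ∘ pre) safe)

  -- The comm rule: the input-bound x starts without authorization, so after
  -- substitution the continuation needs no more than the environment provides.
  input-safe : ∀ Q N → ¬ (c ∈bn Q) → Safe (reset x N) Q → Safe N (Q [ c / x ])
  input-safe Q N c∉ safe =
    Safe-mono (Q [ c / x ]) (λ n _ → ≤-trans (≤-reflexive (merge-reset-self n)) (reset-≤ x N n))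
              (subst-safe Q c∉ safe)
    where
    merge-reset-self : merge (reset x N) ≗ reset x N
    merge-reset-self n = begin
        upd (_+ reset x N x) c (reset x (reset x N)) n
      ≡⟨ cong (λ k → upd (_+ k) c (reset x (reset x N)) n) (upd-≡ _ x N refl) ⟩
        upd (_+ 0) c (reset x (reset x N)) n
      ≡⟨ upd-id (_+ 0) c (reset x (reset x N)) +-identityʳ n ⟩
        reset x (reset x N) n
      ≡⟨ upd-∘ _ _ x N n ⟩
        reset x N n ∎

_⇛_ : Proc → Proc → Set
P ⇛ Q = ∀ M → Safe M P → Safe M Q

Equisafe : Proc → Proc → Set
Equisafe P Q = P ⇛ Q × Q ⇛ P

env-equisafe : ∀ P {F G : Env → Env} → (∀ M → F M ≗ G M) →
               (∀ M → Safe (F M) P → Safe (G M) P) × (∀ M → Safe (G M) P → Safe (F M) P)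
env-equisafe P F≗G = (λ M → Safe-≗ P (F≗G M)) , (λ M → Safe-≗ P (≡-sym ∘ F≗G M))

prefix-⇛ : ∀ π {P Q} → P ⇛ Q → (π · P) ⇛ (π · Q)
prefix-⇛ (out a b)  P⇛Q M (pos , safe) = pos , P⇛Q M safe
prefix-⇛ (inp a x)  P⇛Q M (pos , safe) = pos , P⇛Q _ safe
prefix-⇛ (aout a b) P⇛Q M (posa , posb , safe) = posa , posb , P⇛Q _ safe
prefix-⇛ (ainp a b) P⇛Q M (pos , safe) = pos , P⇛Q _ safe

≡ₛ-equisafe : ∀ {P Q} → P ≡ₛ Q → Equisafe P Q
≡ₛ-equisafe refl = (λ _ safe → safe) , (λ _ safe → safe)
≡ₛ-equisafe (sym Q≡P) = proj₂ (≡ₛ-equisafe Q≡P) , proj₁ (≡ₛ-equisafe Q≡P)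
≡ₛ-equisafe (trans P≡Q Q≡R) =
  (λ M → proj₁ (≡ₛ-equisafe Q≡R) M ∘ proj₁ (≡ₛ-equisafe P≡Q) M) ,
  (λ M → proj₂ (≡ₛ-equisafe P≡Q) M ∘ proj₂ (≡ₛ-equisafe Q≡R) M)
≡ₛ-equisafe (c-par P≡P′ Q≡Q′) =
  (λ M (safeP , safeQ) → proj₁ (≡ₛ-equisafe P≡P′) M safeP , proj₁ (≡ₛ-equisafe Q≡Q′) M safeQ) ,
  (λ M (safeP , safeQ) → proj₂ (≡ₛ-equisafe P≡P′) M safeP , proj₂ (≡ₛ-equisafe Q≡Q′) M safeQ)
≡ₛ-equisafe (c-res {a} P≡Q) =
  (λ M → proj₁ (≡ₛ-equisafe P≡Q) (reset a M)) , (λ M → proj₂ (≡ₛ-equisafe P≡Q) (reset a M))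
≡ₛ-equisafe (c-auth {a} P≡Q) =
  (λ M → proj₁ (≡ₛ-equisafe P≡Q) (inc a M)) , (λ M → proj₂ (≡ₛ-equisafe P≡Q) (inc a M))
≡ₛ-equisafe (c-pre {π} P≡Q) =
  prefix-⇛ π (proj₁ (≡ₛ-equisafe P≡Q)) , prefix-⇛ π (proj₂ (≡ₛ-equisafe P≡Q))
≡ₛ-equisafe par-unit = (λ _ (safe , _) → safe) , (λ _ safe → safe , tt)
≡ₛ-equisafe par-comm = (λ _ (safeP , safeQ) → safeQ , safeP) , (λ _ (safeQ , safeP) → safeP , safeQ)
≡ₛ-equisafe par-assoc =
  (λ _ ((safeP , safeQ) , safeR) → safeP , (safeQ , safeR)) ,
  (λ _ (safeP , (safeQ , safeR)) → (safeP , safeQ) , safeR)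
≡ₛ-equisafe res-zero = (λ _ _ → tt) , (λ _ _ → tt)
≡ₛ-equisafe (res-swap {a} {b} {P}) = env-equisafe P (λ M → upd-comm _ _ b a M (λ _ _ _ → refl))
≡ₛ-equisafe (scope-ext {a} {P} a∉P) =
  (λ M (safeP , safeQ) → Safe-mono P (λ n n∈P → ≤-reflexive (≡-sym (reset-fresh a M a∉P n n∈P))) safeP , safeQ) ,
  (λ M (safeP , safeQ) → Safe-mono P (λ n n∈P → ≤-reflexive (reset-fresh a M a∉P n n∈P)) safeP , safeQ)
≡ₛ-equisafe (α-res {a} {b} {P} b∉P) =
  (λ M → Swapping.α-safe a b P M b∉P) , (λ M → Swapping.α-safe⁻¹ a b P M b∉P)
≡ₛ-equisafe (α-inp {x = x} {y} {P} y∉P) =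
  (λ M (pos , safe) → pos , Swapping.α-safe x y P M y∉P safe) ,
  (λ M (pos , safe) → pos , Swapping.α-safe⁻¹ x y P M y∉P safe)
≡ₛ-equisafe (auth-swap {a} {b} {P}) = env-equisafe P (λ M → upd-comm suc suc b a M (λ _ _ _ → refl))
≡ₛ-equisafe auth-zero = (λ _ _ → tt) , (λ _ _ → tt)
≡ₛ-equisafe auth-par = (λ _ safe → safe) , (λ _ safe → safe)
≡ₛ-equisafe (auth-res {a} {b} {P} a≢b) =
  env-equisafe P (λ M → upd-comm _ suc b a M (λ _ n≡b n≡a → ⊥-elim (a≢b (≡-trans (≡-sym n≡a) n≡b))))

auths-⇛ : ∀ as {R R′} → R ⇛ R′ → auths as R ⇛ auths as R′
auths-⇛ []       R⇛R′ = R⇛R′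
auths-⇛ (a ∷ as) R⇛R′ M = auths-⇛ as R⇛R′ (inc a M)

⟶-safe : ∀ {P Q} → P ⟶ Q → P ⇛ Q
⟶-safe (struct P≡P′ P′⟶Q′ Q′≡Q) M =
  proj₁ (≡ₛ-equisafe Q′≡Q) M ∘ ⟶-safe P′⟶Q′ M ∘ proj₁ (≡ₛ-equisafe P≡P′) M
⟶-safe (r-par P⟶Q) M (safeP , safeR) = ⟶-safe P⟶Q M safeP , safeR
⟶-safe (r-res {a} P⟶Q) M = ⟶-safe P⟶Q (reset a M)
⟶-safe (r-auth {a} P⟶Q) M = ⟶-safe P⟶Q (inc a M)
⟶-safe (comm as₁ as₂ b c x P Q c∉Q) M (sender , receiver) =
  auths-⇛ as₁ (λ _ (_ , safe) → safe) M sender , auths-⇛ as₂ receive M receiver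
  where
  receive : (⟨ b ⟩ (inp b x · Q)) ⇛ (⟨ b ⟩ (Q [ c / x ]))
  receive N (_ , safe) with x ≟ c
  ... | yes refl = subst (Safe (inc b N)) (≡-sym (subst-self Q x))
                         (Safe-mono Q (λ n _ → reset-≤ x (inc b N) n) safe)
  ... | no x≢c = Merge.input-safe x c x≢c Q (inc b N) c∉Q safe
⟶-safe (authr as₁ as₂ b c P Q) M (sender , receiver) =
  auths-⇛ as₁ send M sender , auths-⇛ as₂ (λ _ (_ , safe) → safe) M receiver
  where
  -- the authorization for c granted by the scope (c) is the one given away
  send : (⟨ b ⟩ ⟨ c ⟩ (aout b c · P)) ⇛ (⟨ b ⟩ P)
  send N (_ , _ , safe) =
    Safe-≗ P (λ n → ≡-trans (upd-∘ pred suc c (inc b N) n) (upd-id _ c (inc b N) (λ _ → refl) n)) safe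

⟶⋆-safe : ∀ {P Q} → P ⟶⋆ Q → P ⇛ Q
⟶⋆-safe ε _ safe = safe
⟶⋆-safe (P⟶R ◅ R⟶⋆Q) M = ⟶⋆-safe R⟶⋆Q M ∘ ⟶-safe P⟶R M

upd-outside : ∀ g a M (ρ : NameSet) → a ∉ ρ → (∀ n → n ∈ ρ → 0 < M n) → ∀ n → n ∈ ρ → 0 < upd g a M n
upd-outside g a M ρ a∉ρ pos n n∈ρ =
  subst (0 <_) (≡-sym (upd-≢ g a M (λ n≡a → a∉ρ (subst (_∈ ρ) n≡a n∈ρ)))) (pos n n∈ρ)

typed-safe : ∀ {ρ P} → ρ ⊢ₜ P → ∀ M → (∀ n → n ∈ ρ → 0 < M n) → Safe M P
typed-safe t-zero M pos = tt
typed-safe (t-par ⊢P ⊢Q) M pos = typed-safe ⊢P M (λ n → pos n ∘ inj₁) , typed-safe ⊢Q M (λ n → pos n ∘ inj₂)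
typed-safe (t-res {ρ} {a} ⊢P a∉ρ) M pos = typed-safe ⊢P (reset a M) (upd-outside _ a M ρ a∉ρ pos)
typed-safe (t-auth {a = a} ⊢P) M pos =
  typed-safe ⊢P (inc a M) (λ n n∈ρ → inc-pos a M n (λ n≢a → pos n (n∈ρ , λ a≡n → n≢a (≡-sym a≡n))))
typed-safe (t-out ⊢P) M pos = pos _ (inj₂ refl) , typed-safe ⊢P M (λ n → pos n ∘ inj₁)
typed-safe (t-inp {ρ} {x = x} ⊢P x∉ρ) M pos =
  pos _ (inj₂ refl) , typed-safe ⊢P (reset x M) (upd-outside _ x M ρ x∉ρ (λ n → pos n ∘ inj₁))
typed-safe (t-aout {ρ} {b = b} ⊢P b∉ρ) M pos =
  pos _ (inj₂ (inj₁ refl)) , pos _ (inj₂ (inj₂ refl)) ,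
  typed-safe ⊢P (dec b M) (upd-outside pred b M ρ b∉ρ (λ n → pos n ∘ inj₁))
typed-safe (t-ainp {b = b} ⊢P) M pos =
  pos _ (inj₂ refl) ,
  typed-safe ⊢P (inc b M) (λ n n∈ρ → inc-pos b M n (λ n≢b → pos n (inj₁ (n∈ρ , λ b≡n → n≢b (≡-sym b≡n)))))
typed-safe (t-ext ⊢P (ρ⊆ρ′ , ρ′⊆ρ)) M pos = typed-safe ⊢P M (λ n → pos n ∘ ρ⊆ρ′)

Safe-plug : ∀ C R M → Safe M (plug C R) → Σ Env λ M′ → Safe M′ R × (∀ a → ¬ Auth C a → M′ a ≤ M a)
Safe-plug hole R M safe = M , safe , (λ _ _ → ≤-refl)
Safe-plug (par P C) R M (_ , safe) = Safe-plug C R M safe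
Safe-plug (res b C) R M safe =
  let (M′ , safeR , M′≤) = Safe-plug C R (reset b M) safe
  in M′ , safeR , (λ a ¬auth → ≤-trans (M′≤ a ¬auth) (reset-≤ b M a))
Safe-plug (auth b C) R M safe =
  let (M′ , safeR , M′≤) = Safe-plug C R (inc b M) safe
  in M′ , safeR , (λ a ¬auth → ≤-trans (M′≤ a (¬auth ∘ inj₂)) (≤-reflexive (upd-≢ suc b M (¬auth ∘ inj₁ ∘ ≡-sym))))

subj-pos : ∀ π R M → Safe M (π · R) → 0 < M (subj π)
subj-pos (out a b)  R M (pos , _) = pos
subj-pos (inp a x)  R M (pos , _) = pos
subj-pos (aout a b) R M (pos , _) = pos
subj-pos (ainp a b) R M (pos , _) = pos

bad-prefix-unsafe : ∀ C π R M′ → Safe M′ (π · R) → (∀ a → ¬ Auth C a → M′ a ≤ 0) → ¬ BadPrefix C π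
bad-prefix-unsafe C π R M′ safe M′≤0 (inj₁ ¬auth) = n≮0 (<-≤-trans (subj-pos π R M′ safe) (M′≤0 _ ¬auth))
bad-prefix-unsafe C .(aout a b) R M′ (_ , posb , _) M′≤0 (inj₂ (a , b , refl , ¬auth)) =
  n≮0 (<-≤-trans posb (M′≤0 b ¬auth))

no-auth : Env
no-auth _ = 0

safe-not-error : ∀ Q → Safe no-auth Q → ¬ Error Q
safe-not-error Q safe (C , π , R , Q≡C[πR] , bad) =
  let (M′ , safeπR , M′≤0) = Safe-plug C (π · R) no-auth (proj₁ (≡ₛ-equisafe Q≡C[πR]) no-auth safe)
  in bad-prefix-unsafe C π R M′ safeπR M′≤0 bad

corollary1 : ∀ (P : Proc) → ∅ ⊢ₜ P → ∀ (Q : Proc) → P ⟶⋆ Q → ¬ Error Q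
corollary1 P ⊢P Q P⟶⋆Q =
  safe-not-error Q (⟶⋆-safe P⟶⋆Q no-auth (typed-safe ⊢P no-auth (λ _ ())))
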